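{- If $\Gamma\vdash_{\mathsf w}P$ is derivable (for some context $\Gamma$ and some level function), then $P$ terminates, i.e., there is no infinite sequence $P\xrightarrow{\tau}P_1\xrightarrow{\tau}P_2\xrightarrow{\tau}\cdots$.
   Context: The calculus $\pi_{\mathsf W}$. Processes: $P,Q ::= \overline{x}\langle y_1,y_2\rangle.P \mid x(y_1,y_2).P$ (linear input) $\mid\ !x(y_1,y_2).P$ (server) $\mid P\mid Q \mid (\nu x)P \mid \mathbf 0$; $\tilde y$ denotes a tuple. Labelled transition system with labels $\alpha ::= x(\tilde v) \mid \overline x\langle \tilde v\rangle \mid (\nu y,\tilde b)\overline x\langle\tilde v\rangle \mid \tau$: $x(\tilde y).P \xrightarrow{x(\tilde v)} P\{\tilde v/\tilde y\}$; $!x(\tilde y).P\xrightarrow{x(\tilde v)} !x(\tilde y).P \mid P\{\tilde v/\tilde y\}$; $\overline x\langle\tilde y\rangle.P\xrightarrow{\overline x\langle\tilde y\rangle}P$; if $P\xrightarrow{\alpha}P'$ and $\mathrm{bn}(\alpha)\cap\mathrm{fn}(Q)=\emptyset$ then $P\mid Q\xrightarrow{\alpha}P'\mid Q$; if $P\xrightarrow{\alpha}P'$ and $x\notin\mathrm{n}(\alpha)$ then $(\nu x)P\xrightarrow{\alpha}(\nu x)P'$; if $P\xrightarrow{(\nu\tilde b)\overline x\langle\tilde v\rangle}P'$ and $y\in\mathrm{fn}(\tilde v)\setminus\{\tilde b,x\}$ then $(\nu y)P\xrightarrow{(\nu y,\tilde b)\overline x\langle\tilde v\rangle}P'$; if $P\xrightarrow{(\nu\tilde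 b)\overline x\langle\tilde v\rangle}P'$ ($\tilde b$ possibly empty), $Q\xrightarrow{x(\tilde v)}Q'$ and $\tilde b\cap\mathrm{fn}(Q)=\emptyset$, then $P\mid Q\xrightarrow{\tau}(\nu\tilde b)(P'\mid Q')$; parallel rules apply symmetrically. Types: $V ::= \mathsf i^n[V_1,V_2]$ (linear input) $\mid \mathsf o^n[V_1,V_2]$ (linear output) $\mid \mathsf S^n[V]$ (unrestricted server) $\mid \mathsf C^n[V]$ (unrestricted client) $\mid \mathbf{unit}$, with weights $n\in\{1,2,\dots\}$. Duality: $\overline{\mathsf i^n[V_1,V_2]}=\mathsf o^n[\overline{V_1},\overline{V_2}]$, $\overline{\mathsf o^n[V_1,V_2]}=\mathsf i^n[\overline{V_1},\overline{V_2}]$, $\overline{\mathsf S^n[V]}=\mathsf C^n[\overline V]$, $\overline{\mathsf C^n[V]}=\mathsf S^n[\overline V]$, $\overline{\mathbf{unit}}=\mathbf{unit}$. Contexts: $\Gamma ::= \cdot \mid \Gamma,x:V\mid \Gamma,x::V$, where $x::V$ abbreviates $x:(V,\overline V)$ (pairing of two complementary endpoint types; $(V,\overline V)=(\overline V,V)$), each name at most once. $\mathrm{un}(T)$ holds iff $T$ is $\mathsf S^n[V]$, $\mathsf C^n[V]$ or $\mathbf{unit}$; an entry $x::V$ is unrestricted iff $\mathrm{un}(V)$; $\mathrm{un}(\Gamma)$ iff all entries of $\Gamma$ are unrestricted. Split $\Gamma=\Gamma_1\circ\Gamma_2$: $\emptyset=\emptyset\circ\emptyset$; and, given $\Gamma=\Gamma_1\circ\Gamma_2$: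 if $\mathrm{un}(T)$ then $\Gamma,x:T=(\Gamma_1,x:T)\circ(\Gamma_2,x:T)$; if $\mathrm{un}(V)$ then $\Gamma,x::V=(\Gamma_1,x::V)\circ(\Gamma_2,x::V)$; if $\neg\mathrm{un}(V)$ then $\Gamma,x::V=(\Gamma_1,x:V)\circ(\Gamma_2,x:\overline V)=(\Gamma_1,x::V)\circ\Gamma_2=\Gamma_1\circ(\Gamma_2,x::V)$; if $\neg\mathrm{un}(T)$ then $\Gamma,x:T=(\Gamma_1,x:T)\circ\Gamma_2=\Gamma_1\circ(\Gamma_2,x:T)$. A level function is $l:\mathcal N\to\mathbb N$ on names (bound names assumed pairwise distinct) with $l(x)=n$ if $x$ is assigned (by $:$ or $::$) one of $\mathsf i^n[\cdot,\cdot],\mathsf o^n[\cdot,\cdot],\mathsf S^n[\cdot],\mathsf C^n[\cdot]$, and $l(x)$ arbitrary if $x:\mathbf{unit}$. Active outputs: $\mathrm{os}(\overline x\langle\tilde y\rangle.P)=\{x\}\cup\mathrm{os}(P)$, $\mathrm{os}(x(\tilde y).P)=\mathrm{os}(P)$, $\mathrm{os}(P\mid Q)=\mathrm{os}(P)\cup\mathrm{os}(Q)$, $\mathrm{os}((\nu x)P)=\mathrm{os}(P)$, $\mathrm{os}(\mathbf 0)=\mathrm{os}(!x(\tilde y).P)=\emptyset$. Typing rules (judgments $\Gamma\vdash_{\mathsf w}P$ and $\Gamma\vdash_{\mathsf w}x:V$, relative to $l$): Var$_1$: $\mathrm{un}(\Gamma)\Rightarrow \Gamma,x:V\vdash x:V$.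 Var$_2$: $\mathrm{un}(\Gamma)\Rightarrow\Gamma,x::V\vdash x:V$. Nil: $\mathrm{un}(\Gamma)\Rightarrow\Gamma\vdash\mathbf 0$. Par: $\Gamma_1\vdash P,\ \Gamma_2\vdash Q\Rightarrow\Gamma_1\circ\Gamma_2\vdash P\mid Q$. Res: $\Gamma,x::V\vdash P\Rightarrow\Gamma\vdash(\nu x)P$. Lin-In$_1$: $\Gamma_1,x:\mathsf i^n[V_1,V_2]\vdash x:\mathsf i^n[V_1,V_2]$, $\Gamma_2,y_1:V_1,y_2:V_2\vdash P$, $l(x)=l(y_2)$ $\Rightarrow(\Gamma_1,x:\mathsf i^n[V_1,V_2])\circ\Gamma_2\vdash x(y_1,y_2).P$. Lin-In$_2$: $\Gamma_1,x:\mathsf S^n[V]\vdash x:\mathsf S^n[V]$, $\Gamma_2,x:\mathsf S^n[V],y_1:V,y_2:\mathbf{unit}\vdash P\Rightarrow(\Gamma_1,x:\mathsf S^n[V])\circ(\Gamma_2,x:\mathsf S^n[V])\vdash x(y_1,y_2).P$. Lin-In$_3$: $\Gamma,x::\mathsf S^n[V]\vdash x:\mathsf S^n[V]$, $\Gamma,x::\mathsf S^n[V],y_1:V,y_2:\mathbf{unit}\vdash P\Rightarrow\Gamma,x::\mathsf S^n[V]\vdash x(y_1,y_2).P$. Lin-Out: $\Gamma_1,x:\mathsf o^n[V_1,V_2]\vdash x:\mathsf o^n[V_1,V_2]$, $\Gamma_2,y_1:V_1\vdash y_1:V_1$, $\Gamma_3,y_2:V_2\vdash P$, $l(x)=l(y_2)$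 $\Rightarrow(\Gamma_1,x:\mathsf o^n[V_1,V_2])\circ(\Gamma_2,y_1:V_1)\circ(\Gamma_3,y_2::V_2)\vdash\overline x\langle y_1,y_2\rangle.P$. Un-Out$_1$: $\Gamma_1,x:\mathsf C^n[V]\vdash x:\mathsf C^n[V]$, $\Gamma_2,x:\mathsf C^n[V],y_1:V\vdash y_1:V$, $\Gamma_3,x:\mathsf C^n[V],y_2:\mathbf{unit}\vdash P$ $\Rightarrow(\Gamma_1,x:\mathsf C^n[V])\circ(\Gamma_2,x:\mathsf C^n[V],y_1:V)\circ(\Gamma_3,x:\mathsf C^n[V])\vdash\overline x\langle y_1,y_2\rangle.P$. Un-Out$_2$: the same with every $x:\mathsf C^n[V]$ replaced by $x::\mathsf C^n[V]$. Un-In$_1$: $\Gamma,x:\mathsf S^n[V]\vdash x:\mathsf S^n[V]$, $\Gamma,x:\mathsf S^n[V],y_1:V,y_2:\mathbf{unit}\vdash P$, and $l(b)<n$ for all $b\in\mathrm{os}(P)$ $\Rightarrow\Gamma,x:\mathsf S^n[V]\vdash\ !x(y_1,y_2).P$. Un-In$_2$: the same with $x::\mathsf S^n[V]$ in place of $x:\mathsf S^n[V]$. $\Gamma\vdash_{\mathsf w}P$ holds if it is derivable for some level function. -}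

module Defs where

open import Data.Nat using (ℕ; zero; suc; _<_; _≤_; _≡ᵇ_)
open import Data.Bool using (Bool; true; false; if_then_else_; not; _∨_)
open import Data.List using (List; []; _∷_; _++_; filterᵇ; foldr)
open import Data.List.Membership.Propositional using (_∈_; _∉_)
open import Data.List.Relation.Unary.All using (All)
open import Data.Maybe using (Maybe; just; nothing)
open import Data.Product using (Σ; _×_; ∃)
open import Data.Empty using (⊥)
open import Data.Unit using (⊤)
open import Relation.Nullary using (¬_)
open import Relation.Binary.PropositionalEquality using (_≡_; _≢_)

-- Names and processes of π_W (names are natural numbers; all tuples are
-- pairs, as in the grammar of the paper)

Name : Set
Name = ℕ

infixr 5 _∣_

data Proc : Set where
  out : Name → Name → Name → Proc → Proc
  inp : Name → Name → Name → Proc → Proc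
  rep : Name → Name → Name → Proc → Proc
  _∣_ : Proc → Proc → Proc
  ν   : Name → Proc → Proc
  𝟘   : Proc

_∖_ : List Name → Name → List Name
xs ∖ y = filterᵇ (λ z → not (z ≡ᵇ y)) xs

fn : Proc → List Name
fn (out x y₁ y₂ P) = x ∷ y₁ ∷ y₂ ∷ fn P
fn (inp x y₁ y₂ P) = x ∷ ((fn P ∖ y₁) ∖ y₂)
fn (rep x y₁ y₂ P) = x ∷ ((fn P ∖ y₁) ∖ y₂)
fn (P ∣ Q) = fn P ++ fn Q
fn (ν x P) = fn P ∖ x
fn 𝟘 = []

bnP : Proc → List Name
bnP (out x y₁ y₂ P) = bnP P
bnP (inp x y₁ y₂ P) = y₁ ∷ y₂ ∷ bnP P
bnP (rep x y₁ y₂ P) = y₁ ∷ y₂ ∷ bnP P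
bnP (P ∣ Q) = bnP P ++ bnP Q
bnP (ν x P) = x ∷ bnP P
bnP 𝟘 = []

names : Proc → List Name
names (out x y₁ y₂ P) = x ∷ y₁ ∷ y₂ ∷ names P
names (inp x y₁ y₂ P) = x ∷ y₁ ∷ y₂ ∷ names P
names (rep x y₁ y₂ P) = x ∷ y₁ ∷ y₂ ∷ names P
names (P ∣ Q) = names P ++ names Q
names (ν x P) = x ∷ names P
names 𝟘 = []

os : Proc → List Name
os (out x y₁ y₂ P) = x ∷ os P
os (inp x y₁ y₂ P) = os P
os (rep x y₁ y₂ P) = []
os (P ∣ Q) = os P ++ os Q
os (ν x P) = os P
os 𝟘 = []

_[_↦_] : (Name → Name) → Name → Name → (Name → Name)
(σ [ y ↦ v ]) z = if z ≡ᵇ y then v else σ z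

idN : Name → Name
idN z = z

-- It is capture-avoiding
-- whenever the substituted names are not bound in P; the transition rules
-- below impose that side condition and allow α-conversion, which realises
-- the paper's convention on bound names.
sub : (Name → Name) → Proc → Proc
sub σ (out x y₁ y₂ P) = out (σ x) (σ y₁) (σ y₂) (sub σ P)
sub σ (inp x y₁ y₂ P) = inp (σ x) y₁ y₂ (sub ((σ [ y₁ ↦ y₁ ]) [ y₂ ↦ y₂ ]) P)
sub σ (rep x y₁ y₂ P) = rep (σ x) y₁ y₂ (sub ((σ [ y₁ ↦ y₁ ]) [ y₂ ↦ y₂ ]) P)
sub σ (P ∣ Q) = sub σ P ∣ sub σ Q
sub σ (ν x P) = ν x (sub (σ [ x ↦ x ]) P)
sub σ 𝟘 = 𝟘

subst₂ : Proc → Name → Name → Name → Name → Proc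
subst₂ P v₁ v₂ y₁ y₂ = sub ((idN [ y₂ ↦ v₂ ]) [ y₁ ↦ v₁ ]) P

rename : Name → Name → Proc → Proc
rename x z P = sub (idN [ x ↦ z ]) P

infix 4 _≡α_

data _≡α_ : Proc → Proc → Set where
  α-refl  : ∀ {P} → P ≡α P
  α-sym   : ∀ {P Q} → P ≡α Q → Q ≡α P
  α-trans : ∀ {P Q R} → P ≡α Q → Q ≡α R → P ≡α R
  α-out   : ∀ {x y₁ y₂ P Q} → P ≡α Q → out x y₁ y₂ P ≡α out x y₁ y₂ Q
  α-inp   : ∀ {x y₁ y₂ P Q} → P ≡α Q → inp x y₁ y₂ P ≡α inp x y₁ y₂ Q
  α-rep   : ∀ {x y₁ y₂ P Q} → P ≡α Q → rep x y₁ y₂ P ≡α rep x y₁ y₂ Q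
  α-par   : ∀ {P P' Q Q'} → P ≡α P' → Q ≡α Q' → (P ∣ Q) ≡α (P' ∣ Q')
  α-res   : ∀ {x P Q} → P ≡α Q → ν x P ≡α ν x Q
  α-ν     : ∀ {x z P} → z ∉ names P → ν x P ≡α ν z (rename x z P)
  α-inp₁  : ∀ {x y₁ y₂ z P} → z ∉ names P → z ≢ y₂ → y₁ ≢ y₂ →
            inp x y₁ y₂ P ≡α inp x z y₂ (rename y₁ z P)
  α-inp₂  : ∀ {x y₁ y₂ z P} → z ∉ names P → z ≢ y₁ → y₁ ≢ y₂ →
            inp x y₁ y₂ P ≡α inp x y₁ z (rename y₂ z P)
  α-rep₁  : ∀ {x y₁ y₂ z P} → z ∉ names P → z ≢ y₂ → y₁ ≢ y₂ →
            rep x y₁ y₂ P ≡α rep x z y₂ (rename y₁ z P)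
  α-rep₂  : ∀ {x y₁ y₂ z P} → z ∉ names P → z ≢ y₁ → y₁ ≢ y₂ →
            rep x y₁ y₂ P ≡α rep x y₁ z (rename y₂ z P)

data Label : Set where
  inL  : Name → Name → Name → Label
  outL : List Name → Name → Name → Name → Label   -- (ν b̃) x̄⟨v₁,v₂⟩ ; b̃ = [] is free output
  τ    : Label

bnL : Label → List Name
bnL (inL x v₁ v₂) = []
bnL (outL bs x v₁ v₂) = bs
bnL τ = []

nL : Label → List Name
nL (inL x v₁ v₂) = x ∷ v₁ ∷ v₂ ∷ []
nL (outL bs x v₁ v₂) = bs ++ (x ∷ v₁ ∷ v₂ ∷ [])
nL τ = []

Disjoint : List Name → List Name → Set
Disjoint bs ns = All (λ b → b ∉ ns) bs

νs : List Name → Proc → Proc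
νs bs P = foldr ν P bs

infix 3 _-[_]→_

data _-[_]→_ : Proc → Label → Proc → Set where
  t-inp  : ∀ {x y₁ y₂ v₁ v₂ P} → v₁ ∉ bnP P → v₂ ∉ bnP P →
           inp x y₁ y₂ P -[ inL x v₁ v₂ ]→ subst₂ P v₁ v₂ y₁ y₂
  t-rep  : ∀ {x y₁ y₂ v₁ v₂ P} → v₁ ∉ bnP P → v₂ ∉ bnP P →
           rep x y₁ y₂ P -[ inL x v₁ v₂ ]→ (rep x y₁ y₂ P ∣ subst₂ P v₁ v₂ y₁ y₂)
  t-out  : ∀ {x y₁ y₂ P} → out x y₁ y₂ P -[ outL [] x y₁ y₂ ]→ P
  t-parL : ∀ {P P' Q a} → P -[ a ]→ P' → Disjoint (bnL a) (fn Q) →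
           (P ∣ Q) -[ a ]→ (P' ∣ Q)
  t-parR : ∀ {P Q Q' a} → Q -[ a ]→ Q' → Disjoint (bnL a) (fn P) →
           (P ∣ Q) -[ a ]→ (P ∣ Q')
  t-res  : ∀ {x P P' a} → P -[ a ]→ P' → x ∉ nL a → ν x P -[ a ]→ ν x P'
  t-open : ∀ {y bs x v₁ v₂ P P'} → P -[ outL bs x v₁ v₂ ]→ P' →
           y ∈ (v₁ ∷ v₂ ∷ []) → y ∉ bs → y ≢ x →
           ν y P -[ outL (y ∷ bs) x v₁ v₂ ]→ P'
  t-comL : ∀ {bs x v₁ v₂ P P' Q Q'} → P -[ outL bs x v₁ v₂ ]→ P' →
           Q -[ inL x v₁ v₂ ]→ Q' → Disjoint bs (fn Q) →
           (P ∣ Q) -[ τ ]→ νs bs (P' ∣ Q')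
  t-comR : ∀ {bs x v₁ v₂ P P' Q Q'} → Q -[ outL bs x v₁ v₂ ]→ Q' →
           P -[ inL x v₁ v₂ ]→ P' → Disjoint bs (fn P) →
           (P ∣ Q) -[ τ ]→ νs bs (P' ∣ Q')
  t-α    : ∀ {P P' Q a} → P ≡α P' → P' -[ a ]→ Q → P -[ a ]→ Q

Terminates : Proc → Set
Terminates P = ¬ (Σ (ℕ → Proc) λ f → f zero ≡ P × ((i : ℕ) → f i -[ τ ]→ f (suc i)))

record Weight : Set where
  constructor wt
  field
    val : ℕ
    pos : 1 ≤ val
open Weight public

data Ty : Set where
  𝕚    : Weight → Ty → Ty → Ty
  𝕠    : Weight → Ty → Ty → Ty
  𝕊    : Weight → Ty → Ty
  ℂ    : Weight → Ty → Ty
  unit : Ty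

dual : Ty → Ty
dual (𝕚 n V₁ V₂) = 𝕠 n (dual V₁) (dual V₂)
dual (𝕠 n V₁ V₂) = 𝕚 n (dual V₁) (dual V₂)
dual (𝕊 n V) = ℂ n (dual V)
dual (ℂ n V) = 𝕊 n (dual V)
dual unit = unit

unTy : Ty → Set
unTy (𝕚 _ _ _) = ⊥
unTy (𝕠 _ _ _) = ⊥
unTy (𝕊 _ _) = ⊤
unTy (ℂ _ _) = ⊤
unTy unit = ⊤

weight : Ty → Maybe ℕ
weight (𝕚 n _ _) = just (val n)
weight (𝕠 n _ _) = just (val n)
weight (𝕊 n _) = just (val n)
weight (ℂ n _) = just (val n)
weight unit = nothing

-- Contexts: finite maps from names to entries  x:V  (one V)  or  x::V
-- (both V, i.e. the pair (V, V̄)); a name occurs at most once.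

data Entry : Set where
  one  : Ty → Entry
  both : Ty → Entry

unE : Entry → Set
unE (one T) = unTy T
unE (both V) = unTy V

weightE : Entry → Maybe ℕ
weightE (one T) = weight T
weightE (both V) = weight V

Ctx : Set
Ctx = Name → Maybe Entry

∅ : Ctx
∅ _ = nothing

Finite : Ctx → Set
Finite Γ = ∃ λ N → (x : Name) → N ≤ x → Γ x ≡ nothing

_∉dom_ : Name → Ctx → Set
x ∉dom Γ = Γ x ≡ nothing

extend : Ctx → Name → Entry → Ctx
extend Γ x e z = if z ≡ᵇ x then just e else Γ z

infixl 5 _⸴_∶_ _⸴_∷_

-- Γ, x:V   (used only with x ∉dom Γ)
_⸴_∶_ : Ctx → Name → Ty → Ctx
Γ ⸴ x ∶ V = extend Γ x (one V)

-- Γ, x::V  (used only with x ∉dom Γ)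
_⸴_∷_ : Ctx → Name → Ty → Ctx
Γ ⸴ x ∷ V = extend Γ x (both V)

un : Ctx → Set
un Γ = (x : Name) (e : Entry) → Γ x ≡ just e → unE e

-- identification of entries: (V, V̄) = (V̄, V)
data _≈E_ : Maybe Entry → Maybe Entry → Set where
  ≈-refl : ∀ {e} → e ≈E e
  ≈-dual : ∀ {V} → just (both V) ≈E just (both (dual V))

_≈_ : Ctx → Ctx → Set
Γ ≈ Δ = (x : Name) → Γ x ≈E Δ x

data SplitE : Maybe Entry → Maybe Entry → Maybe Entry → Set where
  s-none     : SplitE nothing nothing nothing
  s-un-one   : ∀ {T} → unTy T → SplitE (just (one T)) (just (one T)) (just (one T))
  s-un-both  : ∀ {V} → unTy V → SplitE (just (both V)) (just (both V)) (just (both V))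
  s-lin-both : ∀ {V} → ¬ unTy V → SplitE (just (both V)) (just (one V)) (just (one (dual V)))
  s-lin-both' : ∀ {V} → ¬ unTy V → SplitE (just (both V)) (just (one (dual V))) (just (one V))
  s-lin-bothL : ∀ {V} → ¬ unTy V → SplitE (just (both V)) (just (both V)) nothing
  s-lin-bothR : ∀ {V} → ¬ unTy V → SplitE (just (both V)) nothing (just (both V))
  s-lin-oneL : ∀ {T} → ¬ unTy T → SplitE (just (one T)) (just (one T)) nothing
  s-lin-oneR : ∀ {T} → ¬ unTy T → SplitE (just (one T)) nothing (just (one T))

Split : Ctx → Ctx → Ctx → Set
Split Γ Γ₁ Γ₂ = (x : Name) → SplitE (Γ x) (Γ₁ x) (Γ₂ x)

Resp : (Name → ℕ) → Ctx → Set
Resp l Γ = (x : Name) (e : Entry) (n : ℕ) → Γ x ≡ just e → weightE e ≡ just n → l x ≡ n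

module Typing (l : Name → ℕ) where

  infix 3 _⊢ₙ_∶_ _⊢_

  data _⊢ₙ_∶_ : Ctx → Name → Ty → Set where
    var₁  : ∀ {Γ x V} → un Γ → x ∉dom Γ → Resp l (Γ ⸴ x ∶ V) →
            Γ ⸴ x ∶ V ⊢ₙ x ∶ V
    var₂  : ∀ {Γ x V} → un Γ → x ∉dom Γ → Resp l (Γ ⸴ x ∷ V) →
            Γ ⸴ x ∷ V ⊢ₙ x ∶ V
    convₙ : ∀ {Γ Δ x V} → Γ ≈ Δ → Δ ⊢ₙ x ∶ V → Γ ⊢ₙ x ∶ V

  data _⊢_ : Ctx → Proc → Set where
    nil   : ∀ {Γ} → un Γ → Resp l Γ → Γ ⊢ 𝟘
    par   : ∀ {Γ Γ₁ Γ₂ P Q} → Γ₁ ⊢ P → Γ₂ ⊢ Q → Split Γ Γ₁ Γ₂ → Resp l Γ →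
            Γ ⊢ P ∣ Q
    res   : ∀ {Γ x V P} → x ∉dom Γ → Γ ⸴ x ∷ V ⊢ P → Resp l Γ → Γ ⊢ ν x P
    linIn₁ : ∀ {Γ Γ₁ Γ₂ x y₁ y₂ n V₁ V₂ P} →
            x ∉dom Γ₁ → y₁ ∉dom Γ₂ → y₂ ∉dom (Γ₂ ⸴ y₁ ∶ V₁) →
            Γ₁ ⸴ x ∶ 𝕚 n V₁ V₂ ⊢ₙ x ∶ 𝕚 n V₁ V₂ →
            Γ₂ ⸴ y₁ ∶ V₁ ⸴ y₂ ∶ V₂ ⊢ P →
            l x ≡ l y₂ →
            Split Γ (Γ₁ ⸴ x ∶ 𝕚 n V₁ V₂) Γ₂ → Resp l Γ →
            Γ ⊢ inp x y₁ y₂ P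
    linIn₂ : ∀ {Γ Γ₁ Γ₂ x y₁ y₂ n V P} →
            x ∉dom Γ₁ → x ∉dom Γ₂ → y₁ ∉dom (Γ₂ ⸴ x ∶ 𝕊 n V) →
            y₂ ∉dom (Γ₂ ⸴ x ∶ 𝕊 n V ⸴ y₁ ∶ V) →
            Γ₁ ⸴ x ∶ 𝕊 n V ⊢ₙ x ∶ 𝕊 n V →
            Γ₂ ⸴ x ∶ 𝕊 n V ⸴ y₁ ∶ V ⸴ y₂ ∶ unit ⊢ P →
            Split Γ (Γ₁ ⸴ x ∶ 𝕊 n V) (Γ₂ ⸴ x ∶ 𝕊 n V) → Resp l Γ →
            Γ ⊢ inp x y₁ y₂ P
    linIn₃ : ∀ {Γ x y₁ y₂ n V P} →
            x ∉dom Γ → y₁ ∉dom (Γ ⸴ x ∷ 𝕊 n V) →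
            y₂ ∉dom (Γ ⸴ x ∷ 𝕊 n V ⸴ y₁ ∶ V) →
            Γ ⸴ x ∷ 𝕊 n V ⊢ₙ x ∶ 𝕊 n V →
            Γ ⸴ x ∷ 𝕊 n V ⸴ y₁ ∶ V ⸴ y₂ ∶ unit ⊢ P →
            Resp l (Γ ⸴ x ∷ 𝕊 n V) →
            Γ ⸴ x ∷ 𝕊 n V ⊢ inp x y₁ y₂ P
    -- three-fold splits A ∘ B ∘ C are read as A ∘ (B ∘ C)
    linOut : ∀ {Γ Γ₁ Γ₂ Γ₃ Γ₂₃ x y₁ y₂ n V₁ V₂ P} →
            x ∉dom Γ₁ → y₁ ∉dom Γ₂ → y₂ ∉dom Γ₃ →
            Γ₁ ⸴ x ∶ 𝕠 n V₁ V₂ ⊢ₙ x ∶ 𝕠 n V₁ V₂ →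
            Γ₂ ⸴ y₁ ∶ V₁ ⊢ₙ y₁ ∶ V₁ →
            Γ₃ ⸴ y₂ ∶ V₂ ⊢ P →
            l x ≡ l y₂ →
            Split Γ (Γ₁ ⸴ x ∶ 𝕠 n V₁ V₂) Γ₂₃ →
            Split Γ₂₃ (Γ₂ ⸴ y₁ ∶ V₁) (Γ₃ ⸴ y₂ ∷ V₂) → Resp l Γ →
            Γ ⊢ out x y₁ y₂ P
    unOut₁ : ∀ {Γ Γ₁ Γ₂ Γ₃ Γ₂₃ x y₁ y₂ n V P} →
            x ∉dom Γ₁ → x ∉dom Γ₂ → y₁ ∉dom (Γ₂ ⸴ x ∶ ℂ n V) →
            x ∉dom Γ₃ → y₂ ∉dom (Γ₃ ⸴ x ∶ ℂ n V) →
            Γ₁ ⸴ x ∶ ℂ n V ⊢ₙ x ∶ ℂ n V →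
            Γ₂ ⸴ x ∶ ℂ n V ⸴ y₁ ∶ V ⊢ₙ y₁ ∶ V →
            Γ₃ ⸴ x ∶ ℂ n V ⸴ y₂ ∶ unit ⊢ P →
            Split Γ (Γ₁ ⸴ x ∶ ℂ n V) Γ₂₃ →
            Split Γ₂₃ (Γ₂ ⸴ x ∶ ℂ n V ⸴ y₁ ∶ V) (Γ₃ ⸴ x ∶ ℂ n V) → Resp l Γ →
            Γ ⊢ out x y₁ y₂ P
    unOut₂ : ∀ {Γ Γ₁ Γ₂ Γ₃ Γ₂₃ x y₁ y₂ n V P} →
            x ∉dom Γ₁ → x ∉dom Γ₂ → y₁ ∉dom (Γ₂ ⸴ x ∷ ℂ n V) →
            x ∉dom Γ₃ → y₂ ∉dom (Γ₃ ⸴ x ∷ ℂ n V) →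
            Γ₁ ⸴ x ∷ ℂ n V ⊢ₙ x ∶ ℂ n V →
            Γ₂ ⸴ x ∷ ℂ n V ⸴ y₁ ∶ V ⊢ₙ y₁ ∶ V →
            Γ₃ ⸴ x ∷ ℂ n V ⸴ y₂ ∶ unit ⊢ P →
            Split Γ (Γ₁ ⸴ x ∷ ℂ n V) Γ₂₃ →
            Split Γ₂₃ (Γ₂ ⸴ x ∷ ℂ n V ⸴ y₁ ∶ V) (Γ₃ ⸴ x ∷ ℂ n V) → Resp l Γ →
            Γ ⊢ out x y₁ y₂ P
    unIn₁ : ∀ {Γ x y₁ y₂ n V P} →
            x ∉dom Γ → y₁ ∉dom (Γ ⸴ x ∶ 𝕊 n V) →
            y₂ ∉dom (Γ ⸴ x ∶ 𝕊 n V ⸴ y₁ ∶ V) →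
            Γ ⸴ x ∶ 𝕊 n V ⊢ₙ x ∶ 𝕊 n V →
            Γ ⸴ x ∶ 𝕊 n V ⸴ y₁ ∶ V ⸴ y₂ ∶ unit ⊢ P →
            All (λ b → l b < val n) (os P) →
            Resp l (Γ ⸴ x ∶ 𝕊 n V) →
            Γ ⸴ x ∶ 𝕊 n V ⊢ rep x y₁ y₂ P
    unIn₂ : ∀ {Γ x y₁ y₂ n V P} →
            x ∉dom Γ → y₁ ∉dom (Γ ⸴ x ∷ 𝕊 n V) →
            y₂ ∉dom (Γ ⸴ x ∷ 𝕊 n V ⸴ y₁ ∶ V) →
            Γ ⸴ x ∷ 𝕊 n V ⊢ₙ x ∶ 𝕊 n V →
            Γ ⸴ x ∷ 𝕊 n V ⸴ y₁ ∶ V ⸴ y₂ ∶ unit ⊢ P →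
            All (λ b → l b < val n) (os P) →
            Resp l (Γ ⸴ x ∷ 𝕊 n V) →
            Γ ⸴ x ∷ 𝕊 n V ⊢ rep x y₁ y₂ P
    -- contexts are finite maps, with (V,V̄) = (V̄,V)
    conv  : ∀ {Γ Δ P} → Γ ≈ Δ → Δ ⊢ P → Γ ⊢ P

_⊢[_]_ : Ctx → (Name → ℕ) → Proc → Set
Γ ⊢[ l ] P = Typing._⊢_ l Γ P

{-# OPTIONS --safe #-}
module Submission where

-- Erase types to sorts that keep only the weights, and measure a process by the sum of
-- Bⁿ over its active outputs, n the weight of the subject, where B exceeds the number of
-- output prefixes of the initial process. A communication on a channel of weight n
-- removes one such output, losing Bⁿ. The receiving side adds nothing new when it is a
-- linear input, whose continuation was already counted; when it is a server it adds a
-- copy of the body, whose fewer than B active outputs all have weight below n (rule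
-- Un-In), hence weigh less than Bⁿ. The sorting records this bound on server bodies and
-- is stable under substitution and α-conversion, so every τ-step strictly decreases a
-- natural number.

open import Defs
open import Data.Nat using (ℕ; zero; suc; _+_; _*_; _^_; _<_; _≤_; _≡ᵇ_; z≤n; s≤s; s≤s⁻¹; _≟_; NonZero)
open import Data.Nat.Properties
  using (≡ᵇ⇒≡; +-assoc; +-comm; +-monoˡ-<; +-monoʳ-<; +-mono-≤; *-monoˡ-≤; ^-monoʳ-≤; m^n>0; m<m+n; m<n+m;
         m≤m+n; m≤n+m; n≤1+n; ≤-trans; ≤-refl; +-commutativeSemigroup; module ≤-Reasoning)
open import Algebra.Properties.CommutativeSemigroup +-commutativeSemigroup
  using (x∙yz≈y∙xz; xy∙z≈xz∙y; x∙yz≈zx∙y)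
open import Data.Nat.Induction using (<-wellFounded)
open import Induction.WellFounded using (Acc; acc)
open import Data.Bool using (true; false; T; not; if_then_else_)
open import Data.Bool.Properties using (¬-not; T-not-≡)
open import Data.Unit using (⊤; tt)
open import Data.Empty using (⊥-elim)
open import Data.Maybe using (Maybe; just; nothing)
import Data.Maybe as Maybe
open import Data.Product using (Σ; ∃; ∃₂; _×_; _,_; proj₁; proj₂)
open import Data.Sum using (_⊎_; inj₁; inj₂)
open import Data.List using (List; []; _∷_; _++_; map; length)
open import Data.Nat.ListAction using (sum)
open import Data.Nat.ListAction.Properties using (sum-++)
open import Data.List.Properties using (length-++; map-++)
open import Data.List.Membership.Propositional using (_∈_; _∉_)
open import Data.List.Membership.Propositional.Properties using (∈-++⁺ˡ; ∈-++⁺ʳ; ∈-filter⁺)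
open import Data.List.Relation.Binary.Subset.Propositional using (_⊆_)
open import Data.List.Relation.Binary.Subset.Propositional.Properties using (∷⁺ʳ; ++⁺; filter-⊆)
open import Data.List.Relation.Unary.All using (All; []; _∷_)
import Data.List.Relation.Unary.All as All
open import Data.List.Relation.Unary.Any using (here; there)
open import Function using (_∘_; flip)
open import Function.Bundles using (_⇔_; mk⇔; Equivalence)
open import Function.Properties.Equivalence using () renaming (refl to ⇔-refl; sym to ⇔-sym; trans to ⇔-trans)
open import Relation.Nullary using (yes; no)
open import Relation.Nullary.Decidable.Core using (T?)
open import Relation.Binary.PropositionalEquality hiding (subst₂)
open import Relation.Binary.PropositionalEquality using () renaming (subst₂ to subst₂-≡)

open Equivalence using (to; from)

≡ᵇ-refl : ∀ n → (n ≡ᵇ n) ≡ true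
≡ᵇ-refl zero = refl
≡ᵇ-refl (suc n) = ≡ᵇ-refl n

≢⇒≡ᵇ-false : ∀ {m n} → m ≢ n → (m ≡ᵇ n) ≡ false
≢⇒≡ᵇ-false {m} {n} m≢n = ¬-not λ m≡ᵇn → m≢n (≡ᵇ⇒≡ m n (subst T (sym m≡ᵇn) tt))

↦-same : ∀ σ y v → (σ [ y ↦ v ]) y ≡ v
↦-same σ y v rewrite ≡ᵇ-refl y = refl

↦-other : ∀ σ {y w} v → w ≢ y → (σ [ y ↦ v ]) w ≡ σ w
↦-other σ v w≢y rewrite ≢⇒≡ᵇ-false w≢y = refl

-- Defs.extend Γ y e is definitionally Γ [ y ≔ e ], so these lemmas also serve typing contexts.
infixl 5 _[_≔_]
_[_≔_] : {A : Set} → (Name → Maybe A) → Name → A → Name → Maybe A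
(Δ [ y ≔ a ]) w = if w ≡ᵇ y then just a else Δ w

≔-same : ∀ {A : Set} (Δ : Name → Maybe A) y a → (Δ [ y ≔ a ]) y ≡ just a
≔-same Δ y a rewrite ≡ᵇ-refl y = refl

≔-other : ∀ {A : Set} (Δ : Name → Maybe A) {y w} a → w ≢ y → (Δ [ y ≔ a ]) w ≡ Δ w
≔-other Δ a w≢y rewrite ≢⇒≡ᵇ-false w≢y = refl

≔-cong : ∀ {A : Set} (Δ Δ′ : Name → Maybe A) {w} y a → Δ w ≡ Δ′ w → (Δ [ y ≔ a ]) w ≡ (Δ′ [ y ≔ a ]) w
≔-cong Δ Δ′ {w} y a eq with w ≡ᵇ y
... | true = refl
... | false = eq

∖-⊆ : ∀ {y} xs → xs ∖ y ⊆ xs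
∖-⊆ {y} = filter-⊆ (T? ∘ λ z → not (z ≡ᵇ y))

⊆-unbind : ∀ y xs → xs ⊆ y ∷ xs ∖ y
⊆-unbind y xs {w} w∈xs with w ≟ y
... | yes w≡y = here w≡y
... | no w≢y = there (∈-filter⁺ (T? ∘ λ z → not (z ≡ᵇ y)) w∈xs (from T-not-≡ (≢⇒≡ᵇ-false w≢y)))

fn-under₂ : ∀ x y₁ y₂ P → fn P ⊆ y₂ ∷ y₁ ∷ fn (inp x y₁ y₂ P)
fn-under₂ x y₁ y₂ P w∈ with ⊆-unbind y₁ (fn P) w∈
... | here w≡y₁ = there (here w≡y₁)
... | there w∈′ with ⊆-unbind y₂ (fn P ∖ y₁) w∈′
...   | here w≡y₂ = here w≡y₂
...   | there w∈″ = there (there (there w∈″))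

fn⊆names : ∀ P → fn P ⊆ names P
fn⊆names (out x y₁ y₂ P) = ∷⁺ʳ x (∷⁺ʳ y₁ (∷⁺ʳ y₂ (fn⊆names P)))
fn⊆names (inp x y₁ y₂ P) = ∷⁺ʳ x λ p → there (there (fn⊆names P (∖-⊆ (fn P) (∖-⊆ (fn P ∖ y₁) p))))
fn⊆names (rep x y₁ y₂ P) = ∷⁺ʳ x λ p → there (there (fn⊆names P (∖-⊆ (fn P) (∖-⊆ (fn P ∖ y₁) p))))
fn⊆names (P ∣ Q) = ++⁺ (fn⊆names P) (fn⊆names Q)
fn⊆names (ν x P) p = there (fn⊆names P (∖-⊆ (fn P) p))
fn⊆names 𝟘 ()

bnP⊆names : ∀ P → bnP P ⊆ names P
bnP⊆names (out x y₁ y₂ P) p = there (there (there (bnP⊆names P p)))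
bnP⊆names (inp x y₁ y₂ P) = there ∘ ∷⁺ʳ y₁ (∷⁺ʳ y₂ (bnP⊆names P))
bnP⊆names (rep x y₁ y₂ P) = there ∘ ∷⁺ʳ y₁ (∷⁺ʳ y₂ (bnP⊆names P))
bnP⊆names (P ∣ Q) = ++⁺ (bnP⊆names P) (bnP⊆names Q)
bnP⊆names (ν x P) = ∷⁺ʳ x (bnP⊆names P)
bnP⊆names 𝟘 ()

↦-self-id : ∀ {σ} y → (∀ z → σ z ≡ z) → ∀ z → (σ [ y ↦ y ]) z ≡ z
↦-self-id {σ} y σ≗id z with z ≟ y
... | yes refl = ↦-same σ z z
... | no z≢y = trans (↦-other σ y z≢y) (σ≗id z)

sub-id : ∀ P {σ} → (∀ z → σ z ≡ z) → sub σ P ≡ P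
sub-id (out x y₁ y₂ P) σ≗id rewrite σ≗id x | σ≗id y₁ | σ≗id y₂ | sub-id P σ≗id = refl
sub-id (inp x y₁ y₂ P) σ≗id rewrite σ≗id x | sub-id P (↦-self-id y₂ (↦-self-id y₁ σ≗id)) = refl
sub-id (rep x y₁ y₂ P) σ≗id rewrite σ≗id x | sub-id P (↦-self-id y₂ (↦-self-id y₁ σ≗id)) = refl
sub-id (P ∣ Q) σ≗id rewrite sub-id P σ≗id | sub-id Q σ≗id = refl
sub-id (ν x P) σ≗id rewrite sub-id P (↦-self-id x σ≗id) = refl
sub-id 𝟘 σ≗id = refl

-- The left disjunct lets σ fix names that also occur bound.
Avoids : (Name → Name) → List Name → Set
Avoids σ bs = ∀ w → σ w ≡ w ⊎ σ w ∉ bs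

avoids-⊆ : ∀ {σ bs bs′} → bs′ ⊆ bs → Avoids σ bs → Avoids σ bs′
avoids-⊆ bs′⊆bs av w with av w
... | inj₁ σw≡w = inj₁ σw≡w
... | inj₂ σw∉bs = inj₂ (σw∉bs ∘ bs′⊆bs)

avoids-bind : ∀ {σ bs} y → Avoids σ bs → Avoids (σ [ y ↦ y ]) bs
avoids-bind {σ} y av w with w ≟ y
... | yes refl = inj₁ (↦-same σ w w)
... | no w≢y rewrite ↦-other σ y w≢y = av w

avoids-≢ : ∀ {σ bs y w} → Avoids σ bs → y ∈ bs → w ≢ y → σ w ≢ y
avoids-≢ {w = w} av y∈bs w≢y σw≡y with av w
... | inj₁ σw≡w = w≢y (trans (sym σw≡w) σw≡y)
... | inj₂ σw∉bs = σw∉bs (subst (_∈ _) (sym σw≡y) y∈bs)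

record Along {A : Set} (R : Maybe A → Maybe A → Set) (σ : Name → Name) (Δ Δ′ : Name → Maybe A)
             (N : List Name) : Set where
  constructor along
  field at : ∀ {w} → w ∈ N → R (Δ w) (Δ′ (σ w))
open Along

module _ {A : Set} (R : Maybe A → Maybe A → Set) (R-refl : ∀ {a} → R a a) where

  along-bind : ∀ {σ Δ Δ′ N bs y} a → Avoids σ bs → y ∈ bs → Along R σ Δ Δ′ N →
               Along R (σ [ y ↦ y ]) (Δ [ y ≔ a ]) (Δ′ [ y ≔ a ]) (y ∷ N)
  along-bind {σ} {Δ} {Δ′} {y = y} a av y∈bs al = along bound
    where
    bound : ∀ {w} → w ∈ y ∷ _ → R ((Δ [ y ≔ a ]) w) ((Δ′ [ y ≔ a ]) ((σ [ y ↦ y ]) w))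
    bound {w} w∈ with w ≟ y | w∈
    ... | yes refl | _ rewrite ↦-same σ w w | ≔-same Δ w a | ≔-same Δ′ w a = R-refl
    ... | no w≢y | here w≡y = ⊥-elim (w≢y w≡y)
    ... | no w≢y | there w∈N
      rewrite ↦-other σ y w≢y | ≔-other Δ a w≢y | ≔-other Δ′ a (avoids-≢ av y∈bs w≢y) = at al w∈N

  along-under : ∀ {σ Δ Δ′ bs} x P a → Avoids σ (x ∷ bs) → Along R σ Δ Δ′ (fn (ν x P)) →
                Along R (σ [ x ↦ x ]) (Δ [ x ≔ a ]) (Δ′ [ x ≔ a ]) (fn P)
  along-under x P a av al = along (at (along-bind a av (here refl) al) ∘ ⊆-unbind x (fn P))

  along-under₂ : ∀ {σ Δ Δ′ bs} x y₁ y₂ P a₁ a₂ → Avoids σ (y₁ ∷ y₂ ∷ bs) → Along R σ Δ Δ′ (fn (inp x y₁ y₂ P)) →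
                 Along R ((σ [ y₁ ↦ y₁ ]) [ y₂ ↦ y₂ ])
                         (Δ [ y₁ ≔ a₁ ] [ y₂ ≔ a₂ ]) (Δ′ [ y₁ ≔ a₁ ] [ y₂ ≔ a₂ ]) (fn P)
  along-under₂ x y₁ y₂ P a₁ a₂ av al =
    along (at (along-bind a₂ (avoids-bind y₁ av) (there (here refl)) (along-bind a₁ av (here refl) al))
           ∘ fn-under₂ x y₁ y₂ P)

avoids-under : ∀ {σ bs} x → Avoids σ (x ∷ bs) → Avoids (σ [ x ↦ x ]) bs
avoids-under x av = avoids-⊆ there (avoids-bind x av)

avoids-under₂ : ∀ {σ bs} y₁ y₂ → Avoids σ (y₁ ∷ y₂ ∷ bs) → Avoids ((σ [ y₁ ↦ y₁ ]) [ y₂ ↦ y₂ ]) bs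
avoids-under₂ y₁ y₂ av = avoids-⊆ (there ∘ there) (avoids-bind y₂ (avoids-bind y₁ av))

data Sort : Set where
  base : Sort
  chan : ℕ → Sort → Sort → Sort

SCtx : Set
SCtx = Name → Maybe Sort

infix 4 _∋_ _≲_ _≼_

-- Base sorts impose nothing: a unit-typed output object may have any type in the outer context.
_∋_ : Maybe Sort → Sort → Set
a ∋ base = ⊤
a ∋ chan n s₁ s₂ = a ≡ just (chan n s₁ s₂)

_≲_ : Maybe Sort → Maybe Sort → Set
a ≲ b = ∀ {s} → a ∋ s → b ∋ s

_≼_ : SCtx → SCtx → Set
Δ ≼ Δ′ = ∀ w → Δ w ≲ Δ′ w

just-∋ : ∀ s → just s ∋ s
just-∋ base = tt
just-∋ (chan n s₁ s₂) = refl

∋⇒just-≲ : ∀ {a s} → a ∋ s → just s ≲ a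
∋⇒just-≲ a∋s {base} _ = tt
∋⇒just-≲ a∋s {chan _ _ _} refl = a∋s

≲-refl : ∀ {a} → a ≲ a
≲-refl a∋s = a∋s

≡⇒≲ : ∀ {a b} → a ≡ b → a ≲ b
≡⇒≲ refl a∋s = a∋s

nothing-≲ : ∀ {a} → nothing ≲ a
nothing-≲ {s = base} _ = tt

base-≲ : ∀ {a} → just base ≲ a
base-≲ {s = base} _ = tt

≼-trans : ∀ {Δ₁ Δ₂ Δ₃} → Δ₁ ≼ Δ₂ → Δ₂ ≼ Δ₃ → Δ₁ ≼ Δ₃
≼-trans Δ₁≼Δ₂ Δ₂≼Δ₃ w = Δ₂≼Δ₃ w ∘ Δ₁≼Δ₂ w

≼-reflexive : ∀ {Δ Δ′} → (∀ w → Δ w ≡ Δ′ w) → Δ ≼ Δ′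
≼-reflexive Δ≗Δ′ w = ≡⇒≲ (Δ≗Δ′ w)

≼-≔ : ∀ {Δ Δ′} y s → Δ ≼ Δ′ → Δ [ y ≔ s ] ≼ Δ′ [ y ≔ s ]
≼-≔ y s Δ≼Δ′ w with w ≡ᵇ y
... | true = ≲-refl
... | false = Δ≼Δ′ w

≼-≔-base : ∀ {Δ Δ′} y → Δ ≼ Δ′ → Δ [ y ≔ base ] ≼ Δ′
≼-≔-base y Δ≼Δ′ w with w ≡ᵇ y
... | true = base-≲
... | false = Δ≼Δ′ w

Moved : SCtx → Name → Name → SCtx → Set
Moved Δ x z Δ′ = Δ x ≡ Δ′ z × (∀ {w} → w ≢ x → w ≢ z → Δ w ≡ Δ′ w)

moved-≔ : ∀ Δ x z s → Moved (Δ [ x ≔ s ]) x z (Δ [ z ≔ s ])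
moved-≔ Δ x z s = trans (≔-same Δ x s) (sym (≔-same Δ z s)) ,
                  λ w≢x w≢z → trans (≔-other Δ s w≢x) (sym (≔-other Δ s w≢z))

moved-≔-under : ∀ {Δ Δ′ x z} y s → y ≢ x → y ≢ z → Moved Δ x z Δ′ → Moved (Δ [ y ≔ s ]) x z (Δ′ [ y ≔ s ])
moved-≔-under {Δ} {Δ′} y s y≢x y≢z (x↦z , rest) =
  trans (≔-other Δ s (y≢x ∘ sym)) (trans x↦z (sym (≔-other Δ′ s (y≢z ∘ sym)))) ,
  λ w≢x w≢z → ≔-cong Δ Δ′ y s (rest w≢x w≢z)

Sorts : List Name → Set
Sorts = All (λ _ → Sort)

bindAll : SCtx → (bs : List Name) → Sorts bs → SCtx
bindAll Δ [] [] = Δ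
bindAll Δ (b ∷ bs) (s ∷ Θ) = bindAll (Δ [ b ≔ s ]) bs Θ

bindAll-cong : ∀ {Δ Δ′ w} bs Θ → Δ w ≡ Δ′ w → bindAll Δ bs Θ w ≡ bindAll Δ′ bs Θ w
bindAll-cong [] [] eq = eq
bindAll-cong {Δ} {Δ′} (b ∷ bs) (s ∷ Θ) eq = bindAll-cong bs Θ (≔-cong Δ Δ′ b s eq)

bindAll-∉ : ∀ {Δ w} bs Θ → w ∉ bs → bindAll Δ bs Θ w ≡ Δ w
bindAll-∉ [] [] _ = refl
bindAll-∉ {Δ} (b ∷ bs) (s ∷ Θ) w∉ = trans (bindAll-∉ bs Θ (w∉ ∘ there)) (≔-other Δ s (w∉ ∘ here))

bindAll-≔ : ∀ {Δ y} s bs Θ → y ∉ bs → ∀ w → bindAll (Δ [ y ≔ s ]) bs Θ w ≡ (bindAll Δ bs Θ [ y ≔ s ]) w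
bindAll-≔ {Δ} {y} s bs Θ y∉ w with w ≟ y
... | yes refl = trans (bindAll-∉ bs Θ y∉) (trans (≔-same Δ w s) (sym (≔-same (bindAll Δ bs Θ) w s)))
... | no w≢y = trans (bindAll-cong bs Θ (≔-other Δ s w≢y)) (sym (≔-other (bindAll Δ bs Θ) s w≢y))

+-monoˡ-<-+ : ∀ {a a′} b c → a′ < a + b → a′ + c < a + c + b
+-monoˡ-<-+ {a} {a′} b c a′<a+b = begin-strict
  a′ + c     <⟨ +-monoˡ-< c a′<a+b ⟩
  a + b + c  ≡⟨ xy∙z≈xz∙y a b c ⟩
  a + c + b  ∎
  where open ≤-Reasoning

+-monoʳ-<-+ : ∀ {c c′} a b → c′ < c + b → a + c′ < a + c + b
+-monoʳ-<-+ {c} {c′} a b c′<c+b = begin-strict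
  a + c′        <⟨ +-monoʳ-< a c′<c+b ⟩
  a + (c + b)   ≡⟨ +-assoc a c b ⟨
  a + c + b     ∎
  where open ≤-Reasoning

module Measured (B : ℕ) .⦃ _ : NonZero B ⦄ where

  infix 4 _⊢_⇓_

  data _⊢_⇓_ : SCtx → Proc → ℕ → Set where
    𝟘⇓   : ∀ {Δ} → Δ ⊢ 𝟘 ⇓ 0
    out⇓ : ∀ {Δ x y₁ y₂ n s₁ s₂ P m} → Δ x ∋ chan n s₁ s₂ → Δ y₁ ∋ s₁ → Δ y₂ ∋ s₂ →
           Δ ⊢ P ⇓ m → Δ ⊢ out x y₁ y₂ P ⇓ B ^ n + m
    inp⇓ : ∀ {Δ x y₁ y₂ n s₁ s₂ P m} → Δ x ∋ chan n s₁ s₂ → y₁ ≢ y₂ →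
           Δ [ y₁ ≔ s₁ ] [ y₂ ≔ s₂ ] ⊢ P ⇓ m → Δ ⊢ inp x y₁ y₂ P ⇓ m
    rep⇓ : ∀ {Δ x y₁ y₂ n s₁ s₂ P m} → Δ x ∋ chan n s₁ s₂ → y₁ ≢ y₂ →
           Δ [ y₁ ≔ s₁ ] [ y₂ ≔ s₂ ] ⊢ P ⇓ m → m < B ^ n → Δ ⊢ rep x y₁ y₂ P ⇓ 0
    par⇓ : ∀ {Δ P Q m₁ m₂} → Δ ⊢ P ⇓ m₁ → Δ ⊢ Q ⇓ m₂ → Δ ⊢ P ∣ Q ⇓ m₁ + m₂
    ν⇓   : ∀ {Δ x P m} s → Δ [ x ≔ s ] ⊢ P ⇓ m → Δ ⊢ ν x P ⇓ m

  ⇓-sub : ∀ P {σ Δ Δ′ m} → Avoids σ (bnP P) → Along _≲_ σ Δ Δ′ (fn P) → Δ ⊢ P ⇓ m → Δ′ ⊢ sub σ P ⇓ m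
  ⇓-sub (out x y₁ y₂ P) av al (out⇓ x∋ y₁∋ y₂∋ d) =
    out⇓ (at al (here refl) x∋) (at al (there (here refl)) y₁∋) (at al (there (there (here refl))) y₂∋)
         (⇓-sub P av (along (at al ∘ there ∘ there ∘ there)) d)
  ⇓-sub (inp x y₁ y₂ P) av al (inp⇓ {s₁ = s₁} {s₂} x∋ y₁≢y₂ d) =
    inp⇓ (at al (here refl) x∋) y₁≢y₂
         (⇓-sub P (avoids-under₂ y₁ y₂ av) (along-under₂ _≲_ ≲-refl x y₁ y₂ P s₁ s₂ av al) d)
  ⇓-sub (rep x y₁ y₂ P) av al (rep⇓ {s₁ = s₁} {s₂} x∋ y₁≢y₂ d m<Bⁿ) =
    rep⇓ (at al (here refl) x∋) y₁≢y₂
         (⇓-sub P (avoids-under₂ y₁ y₂ av) (along-under₂ _≲_ ≲-refl x y₁ y₂ P s₁ s₂ av al) d) m<Bⁿ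
  ⇓-sub (P ∣ Q) av al (par⇓ dP dQ) =
    par⇓ (⇓-sub P (avoids-⊆ (∈-++⁺ˡ) av) (along (at al ∘ ∈-++⁺ˡ)) dP)
         (⇓-sub Q (avoids-⊆ (∈-++⁺ʳ (bnP P)) av) (along (at al ∘ ∈-++⁺ʳ (fn P))) dQ)
  ⇓-sub (ν x P) av al (ν⇓ s d) =
    ν⇓ s (⇓-sub P (avoids-under x av) (along-under _≲_ ≲-refl x P s av al) d)
  ⇓-sub 𝟘 av al 𝟘⇓ = 𝟘⇓

  ⇓-sub⁻ : ∀ P {σ Δ Δ′ m} → Avoids σ (bnP P) → Along (flip _≲_) σ Δ Δ′ (fn P) → Δ′ ⊢ sub σ P ⇓ m → Δ ⊢ P ⇓ m
  ⇓-sub⁻ (out x y₁ y₂ P) av al (out⇓ x∋ y₁∋ y₂∋ d) =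
    out⇓ (at al (here refl) x∋) (at al (there (here refl)) y₁∋) (at al (there (there (here refl))) y₂∋)
         (⇓-sub⁻ P av (along (at al ∘ there ∘ there ∘ there)) d)
  ⇓-sub⁻ (inp x y₁ y₂ P) av al (inp⇓ {s₁ = s₁} {s₂} x∋ y₁≢y₂ d) =
    inp⇓ (at al (here refl) x∋) y₁≢y₂
         (⇓-sub⁻ P (avoids-under₂ y₁ y₂ av) (along-under₂ (flip _≲_) ≲-refl x y₁ y₂ P s₁ s₂ av al) d)
  ⇓-sub⁻ (rep x y₁ y₂ P) av al (rep⇓ {s₁ = s₁} {s₂} x∋ y₁≢y₂ d m<Bⁿ) =
    rep⇓ (at al (here refl) x∋) y₁≢y₂
         (⇓-sub⁻ P (avoids-under₂ y₁ y₂ av) (along-under₂ (flip _≲_) ≲-refl x y₁ y₂ P s₁ s₂ av al) d) m<Bⁿ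
  ⇓-sub⁻ (P ∣ Q) av al (par⇓ dP dQ) =
    par⇓ (⇓-sub⁻ P (avoids-⊆ (∈-++⁺ˡ) av) (along (at al ∘ ∈-++⁺ˡ)) dP)
         (⇓-sub⁻ Q (avoids-⊆ (∈-++⁺ʳ (bnP P)) av) (along (at al ∘ ∈-++⁺ʳ (fn P))) dQ)
  ⇓-sub⁻ (ν x P) av al (ν⇓ s d) =
    ν⇓ s (⇓-sub⁻ P (avoids-under x av) (along-under (flip _≲_) ≲-refl x P s av al) d)
  ⇓-sub⁻ 𝟘 av al 𝟘⇓ = 𝟘⇓

  ⇓-weaken : ∀ {P Δ Δ′ m} → Along _≲_ idN Δ Δ′ (fn P) → Δ ⊢ P ⇓ m → Δ′ ⊢ P ⇓ m
  ⇓-weaken {P} al d = subst (_ ⊢_⇓ _) (sub-id P λ _ → refl) (⇓-sub P (λ _ → inj₁ refl) al d)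

  ⇓-rename : ∀ {P x z Δ Δ′ m} → z ∉ names P → Moved Δ x z Δ′ → Δ ⊢ P ⇓ m ⇔ Δ′ ⊢ rename x z P ⇓ m
  ⇓-rename {P} {x} {z} {Δ} {Δ′} z∉P (x↦z , rest) =
    mk⇔ (⇓-sub P avoids (along (≡⇒≲ ∘ agrees))) (⇓-sub⁻ P avoids (along (≡⇒≲ ∘ sym ∘ agrees)))
    where
    avoids : Avoids (idN [ x ↦ z ]) (bnP P)
    avoids w with w ≟ x
    ... | yes refl = inj₂ (subst (_∉ bnP P) (sym (↦-same idN w z)) (z∉P ∘ bnP⊆names P))
    ... | no w≢x = inj₁ (↦-other idN z w≢x)
    agrees : ∀ {w} → w ∈ fn P → Δ w ≡ Δ′ ((idN [ x ↦ z ]) w)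
    agrees {w} w∈P with w ≟ x
    ... | yes refl rewrite ↦-same idN w z = x↦z
    ... | no w≢x rewrite ↦-other idN z w≢x = rest w≢x λ { refl → z∉P (fn⊆names P w∈P) }

  ⇓-rename-outer : ∀ {P y₁ y₂ z Δ s₁ s₂ m} → z ∉ names P → y₁ ≢ y₂ → z ≢ y₂ →
                   Δ [ y₁ ≔ s₁ ] [ y₂ ≔ s₂ ] ⊢ P ⇓ m ⇔ Δ [ z ≔ s₁ ] [ y₂ ≔ s₂ ] ⊢ rename y₁ z P ⇓ m
  ⇓-rename-outer {y₁ = y₁} {y₂} {z} {Δ} {s₁} {s₂} z∉P y₁≢y₂ z≢y₂ =
    ⇓-rename z∉P (moved-≔-under y₂ s₂ (y₁≢y₂ ∘ sym) (z≢y₂ ∘ sym) (moved-≔ Δ y₁ z s₁))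

  ⇓-rename-inner : ∀ {P y₁ y₂ z Δ s₁ s₂ m} → z ∉ names P →
                   Δ [ y₁ ≔ s₁ ] [ y₂ ≔ s₂ ] ⊢ P ⇓ m ⇔ Δ [ y₁ ≔ s₁ ] [ z ≔ s₂ ] ⊢ rename y₂ z P ⇓ m
  ⇓-rename-inner {y₁ = y₁} {y₂} {z} {Δ} {s₁} {s₂} z∉P = ⇓-rename z∉P (moved-≔ (Δ [ y₁ ≔ s₁ ]) y₂ z s₂)

  ⇓-α : ∀ {P Q} → P ≡α Q → ∀ {Δ m} → Δ ⊢ P ⇓ m ⇔ Δ ⊢ Q ⇓ m
  ⇓-α α-refl = ⇔-refl
  ⇓-α (α-sym P≡Q) = ⇔-sym (⇓-α P≡Q)
  ⇓-α (α-trans P≡Q Q≡R) = ⇔-trans (⇓-α P≡Q) (⇓-α Q≡R)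
  ⇓-α (α-out P≡Q) = mk⇔ (λ { (out⇓ x∋ y₁∋ y₂∋ d) → out⇓ x∋ y₁∋ y₂∋ (to (⇓-α P≡Q) d) })
                        (λ { (out⇓ x∋ y₁∋ y₂∋ d) → out⇓ x∋ y₁∋ y₂∋ (from (⇓-α P≡Q) d) })
  ⇓-α (α-inp P≡Q) = mk⇔ (λ { (inp⇓ x∋ y₁≢y₂ d) → inp⇓ x∋ y₁≢y₂ (to (⇓-α P≡Q) d) })
                        (λ { (inp⇓ x∋ y₁≢y₂ d) → inp⇓ x∋ y₁≢y₂ (from (⇓-α P≡Q) d) })
  ⇓-α (α-rep P≡Q) = mk⇔ (λ { (rep⇓ x∋ y₁≢y₂ d m<Bⁿ) → rep⇓ x∋ y₁≢y₂ (to (⇓-α P≡Q) d) m<Bⁿ })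
                        (λ { (rep⇓ x∋ y₁≢y₂ d m<Bⁿ) → rep⇓ x∋ y₁≢y₂ (from (⇓-α P≡Q) d) m<Bⁿ })
  ⇓-α (α-par P≡P′ Q≡Q′) = mk⇔ (λ { (par⇓ dP dQ) → par⇓ (to (⇓-α P≡P′) dP) (to (⇓-α Q≡Q′) dQ) })
                              (λ { (par⇓ dP dQ) → par⇓ (from (⇓-α P≡P′) dP) (from (⇓-α Q≡Q′) dQ) })
  ⇓-α (α-res P≡Q) = mk⇔ (λ { (ν⇓ s d) → ν⇓ s (to (⇓-α P≡Q) d) })
                        (λ { (ν⇓ s d) → ν⇓ s (from (⇓-α P≡Q) d) })
  ⇓-α (α-ν {x} {z} z∉P) {Δ} =
    mk⇔ (λ { (ν⇓ s d) → ν⇓ s (to (⇓-rename z∉P (moved-≔ Δ x z s)) d) })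
        (λ { (ν⇓ s d) → ν⇓ s (from (⇓-rename z∉P (moved-≔ Δ x z s)) d) })
  ⇓-α (α-inp₁ z∉P z≢y₂ y₁≢y₂) =
    mk⇔ (λ { (inp⇓ x∋ _ d) → inp⇓ x∋ z≢y₂ (to (⇓-rename-outer z∉P y₁≢y₂ z≢y₂) d) })
        (λ { (inp⇓ x∋ _ d) → inp⇓ x∋ y₁≢y₂ (from (⇓-rename-outer z∉P y₁≢y₂ z≢y₂) d) })
  ⇓-α (α-inp₂ z∉P z≢y₁ y₁≢y₂) =
    mk⇔ (λ { (inp⇓ x∋ _ d) → inp⇓ x∋ (z≢y₁ ∘ sym) (to (⇓-rename-inner z∉P) d) })
        (λ { (inp⇓ x∋ _ d) → inp⇓ x∋ y₁≢y₂ (from (⇓-rename-inner z∉P) d) })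
  ⇓-α (α-rep₁ z∉P z≢y₂ y₁≢y₂) =
    mk⇔ (λ { (rep⇓ x∋ _ d m<Bⁿ) → rep⇓ x∋ z≢y₂ (to (⇓-rename-outer z∉P y₁≢y₂ z≢y₂) d) m<Bⁿ })
        (λ { (rep⇓ x∋ _ d m<Bⁿ) → rep⇓ x∋ y₁≢y₂ (from (⇓-rename-outer z∉P y₁≢y₂ z≢y₂) d) m<Bⁿ })
  ⇓-α (α-rep₂ z∉P z≢y₁ y₁≢y₂) =
    mk⇔ (λ { (rep⇓ x∋ _ d m<Bⁿ) → rep⇓ x∋ (z≢y₁ ∘ sym) (to (⇓-rename-inner z∉P) d) m<Bⁿ })
        (λ { (rep⇓ x∋ _ d m<Bⁿ) → rep⇓ x∋ y₁≢y₂ (from (⇓-rename-inner z∉P) d) m<Bⁿ })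

  ⇓-νs : ∀ {Δ R m} bs Θ → bindAll Δ bs Θ ⊢ R ⇓ m → Δ ⊢ νs bs R ⇓ m
  ⇓-νs [] [] d = d
  ⇓-νs (b ∷ bs) (s ∷ Θ) d = ν⇓ s (⇓-νs bs Θ d)

  ⇓-bindAll : ∀ {Δ Q m} bs Θ → Disjoint bs (fn Q) → Δ ⊢ Q ⇓ m → bindAll Δ bs Θ ⊢ Q ⇓ m
  ⇓-bindAll bs Θ disj =
    ⇓-weaken (along λ w∈Q → ≡⇒≲ (sym (bindAll-∉ bs Θ λ w∈bs → All.lookup disj w∈bs w∈Q)))

  record Emits (Δ : SCtx) (bs : List Name) (x v₁ v₂ : Name) (P′ : Proc) (m : ℕ) : Set where
    constructor emits
    field
      Θ        : Sorts bs
      n        : ℕ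
      s₁ s₂    : Sort
      rest     : ℕ
      x∋       : bindAll Δ bs Θ x ∋ chan n s₁ s₂
      v₁∋      : bindAll Δ bs Θ v₁ ∋ s₁
      v₂∋      : bindAll Δ bs Θ v₂ ∋ s₂
      residual : bindAll Δ bs Θ ⊢ P′ ⇓ rest
      consumed : m ≡ B ^ n + rest

  ⇓-output : ∀ {Δ P P′ bs x v₁ v₂ m} → Δ ⊢ P ⇓ m → P -[ outL bs x v₁ v₂ ]→ P′ → Emits Δ bs x v₁ v₂ P′ m
  ⇓-output (out⇓ x∋ y₁∋ y₂∋ d) t-out = emits [] _ _ _ _ x∋ y₁∋ y₂∋ d refl
  ⇓-output (par⇓ {m₂ = c} dP dQ) (t-parL P→ disj) with ⇓-output dP P→
  ... | emits Θ n s₁ s₂ rest x∋ v₁∋ v₂∋ dP′ refl =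
    emits Θ n s₁ s₂ (rest + c) x∋ v₁∋ v₂∋ (par⇓ dP′ (⇓-bindAll _ Θ disj dQ)) (+-assoc (B ^ n) rest c)
  ⇓-output (par⇓ {m₁ = a} dP dQ) (t-parR Q→ disj) with ⇓-output dQ Q→
  ... | emits Θ n s₁ s₂ rest x∋ v₁∋ v₂∋ dQ′ refl =
    emits Θ n s₁ s₂ (a + rest) x∋ v₁∋ v₂∋ (par⇓ (⇓-bindAll _ Θ disj dP) dQ′) (x∙yz≈y∙xz a (B ^ n) rest)
  ⇓-output {Δ} {bs = bs} {x} {v₁} {v₂} (ν⇓ {x = y} s d) (t-res P→ y∉α) with ⇓-output d P→
  ... | emits Θ n s₁ s₂ rest x∋ v₁∋ v₂∋ d′ m≡ =
    emits Θ n s₁ s₂ rest (unshadow (here refl) x∋) (unshadow (there (here refl)) v₁∋)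
          (unshadow (there (there (here refl))) v₂∋)
          (ν⇓ s (⇓-weaken (along λ {w} _ → ≡⇒≲ (bindAll-≔ s bs Θ (y∉α ∘ ∈-++⁺ˡ) w)) d′)) m≡
    where
    unshadow : ∀ {v t} → v ∈ x ∷ v₁ ∷ v₂ ∷ [] → bindAll (Δ [ y ≔ s ]) bs Θ v ∋ t → bindAll Δ bs Θ v ∋ t
    unshadow v∈ = subst (_∋ _) (bindAll-cong bs Θ (≔-other Δ s λ { refl → y∉α (∈-++⁺ʳ bs v∈) }))
  ⇓-output (ν⇓ s d) (t-open P→ _ _ _) with ⇓-output d P→
  ... | emits Θ n s₁ s₂ rest x∋ v₁∋ v₂∋ d′ m≡ = emits (s ∷ Θ) n s₁ s₂ rest x∋ v₁∋ v₂∋ d′ m≡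
  ⇓-output d (t-α P≡P′ P′→) = ⇓-output (to (⇓-α P≡P′) d) P′→

  ⇓-subst₂ : ∀ {Δ P y₁ y₂ v₁ v₂ s₁ s₂ m} → y₁ ≢ y₂ → v₁ ∉ bnP P → v₂ ∉ bnP P → Δ v₁ ∋ s₁ → Δ v₂ ∋ s₂ →
             Δ [ y₁ ≔ s₁ ] [ y₂ ≔ s₂ ] ⊢ P ⇓ m → Δ ⊢ subst₂ P v₁ v₂ y₁ y₂ ⇓ m
  ⇓-subst₂ {Δ} {P} {y₁} {y₂} {v₁} {v₂} {s₁} {s₂} y₁≢y₂ v₁∉P v₂∉P v₁∋ v₂∋ = ⇓-sub P avoids (along sorts)
    where
    σ₂ : Name → Name
    σ₂ = idN [ y₂ ↦ v₂ ]
    avoids : Avoids (σ₂ [ y₁ ↦ v₁ ]) (bnP P)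
    avoids w with w ≟ y₁ | w ≟ y₂
    ... | yes refl | _ rewrite ↦-same σ₂ w v₁ = inj₂ v₁∉P
    ... | no w≢y₁ | yes refl rewrite ↦-other σ₂ v₁ w≢y₁ | ↦-same idN w v₂ = inj₂ v₂∉P
    ... | no w≢y₁ | no w≢y₂ rewrite ↦-other σ₂ v₁ w≢y₁ | ↦-other idN v₂ w≢y₂ = inj₁ refl
    sorts : ∀ {w} → w ∈ fn P → (Δ [ y₁ ≔ s₁ ] [ y₂ ≔ s₂ ]) w ≲ Δ ((σ₂ [ y₁ ↦ v₁ ]) w)
    sorts {w} _ with w ≟ y₁ | w ≟ y₂
    ... | yes refl | _ rewrite ↦-same σ₂ w v₁ | ≔-other (Δ [ w ≔ s₁ ]) s₂ y₁≢y₂ | ≔-same Δ w s₁ = ∋⇒just-≲ v₁∋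
    ... | no w≢y₁ | yes refl rewrite ↦-other σ₂ v₁ w≢y₁ | ↦-same idN w v₂ | ≔-same (Δ [ y₁ ≔ s₁ ]) w s₂ =
      ∋⇒just-≲ v₂∋
    ... | no w≢y₁ | no w≢y₂ rewrite ↦-other σ₂ v₁ w≢y₁ | ↦-other idN v₂ w≢y₂
                                  | ≔-other (Δ [ y₁ ≔ s₁ ]) s₂ w≢y₂ | ≔-other Δ s₁ w≢y₁ = ≲-refl

  ⇓-input : ∀ {Δ Q Q′ x v₁ v₂ n s₁ s₂ m} → Δ ⊢ Q ⇓ m → Q -[ inL x v₁ v₂ ]→ Q′ →
            Δ x ∋ chan n s₁ s₂ → Δ v₁ ∋ s₁ → Δ v₂ ∋ s₂ → ∃ λ m′ → Δ ⊢ Q′ ⇓ m′ × m′ < m + B ^ n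
  ⇓-input {n = n} (inp⇓ x∋ y₁≢y₂ d) (t-inp v₁∉ v₂∉) x∋′ v₁∋ v₂∋ with trans (sym x∋) x∋′
  ... | refl = _ , ⇓-subst₂ y₁≢y₂ v₁∉ v₂∉ v₁∋ v₂∋ d , m<m+n _ (m^n>0 B n)
  ⇓-input (rep⇓ x∋ y₁≢y₂ d m<Bⁿ) (t-rep v₁∉ v₂∉) x∋′ v₁∋ v₂∋ with trans (sym x∋) x∋′
  ... | refl = _ , par⇓ (rep⇓ x∋ y₁≢y₂ d m<Bⁿ) (⇓-subst₂ y₁≢y₂ v₁∉ v₂∉ v₁∋ v₂∋ d) , m<Bⁿ
  ⇓-input {n = n} (par⇓ {m₂ = c} dP dQ) (t-parL P→ _) x∋ v₁∋ v₂∋ with ⇓-input dP P→ x∋ v₁∋ v₂∋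
  ... | a′ , dP′ , a′< = a′ + c , par⇓ dP′ dQ , +-monoˡ-<-+ (B ^ n) c a′<
  ⇓-input {n = n} (par⇓ {m₁ = a} dP dQ) (t-parR Q→ _) x∋ v₁∋ v₂∋ with ⇓-input dQ Q→ x∋ v₁∋ v₂∋
  ... | c′ , dQ′ , c′< = a + c′ , par⇓ dP dQ′ , +-monoʳ-<-+ a (B ^ n) c′<
  ⇓-input {Δ} {x = x} {v₁} {v₂} (ν⇓ {x = y} s d) (t-res Q→ y∉α) x∋ v₁∋ v₂∋
    with ⇓-input d Q→ (shadow (here refl) x∋) (shadow (there (here refl)) v₁∋)
                      (shadow (there (there (here refl))) v₂∋)
    where
    shadow : ∀ {v t} → v ∈ x ∷ v₁ ∷ v₂ ∷ [] → Δ v ∋ t → (Δ [ y ≔ s ]) v ∋ t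
    shadow v∈ = subst (_∋ _) (sym (≔-other Δ s λ { refl → y∉α v∈ }))
  ... | m′ , d′ , m′< = m′ , ν⇓ s d′ , m′<
  ⇓-input d (t-α Q≡Q′ Q′→) x∋ v₁∋ v₂∋ = ⇓-input (to (⇓-α Q≡Q′) d) Q′→ x∋ v₁∋ v₂∋

  communicate : ∀ {Δ P P′ Q Q′ bs x v₁ v₂ a c} → Δ ⊢ P ⇓ a → P -[ outL bs x v₁ v₂ ]→ P′ →
                Δ ⊢ Q ⇓ c → Q -[ inL x v₁ v₂ ]→ Q′ → Disjoint bs (fn Q) →
                Σ (Sorts bs) λ Θ → ∃₂ λ a′ c′ →
                  bindAll Δ bs Θ ⊢ P′ ⇓ a′ × bindAll Δ bs Θ ⊢ Q′ ⇓ c′ × a′ + c′ < a + c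
  communicate {bs = bs} {c = c} dP P→ dQ Q→ disj with ⇓-output dP P→
  ... | emits Θ n s₁ s₂ rest x∋ v₁∋ v₂∋ dP′ refl with ⇓-input (⇓-bindAll bs Θ disj dQ) Q→ x∋ v₁∋ v₂∋
  ...   | c′ , dQ′ , c′<c+Bⁿ = Θ , rest , c′ , dP′ , dQ′ , decrease
    where
    open ≤-Reasoning
    decrease : rest + c′ < B ^ n + rest + c
    decrease = begin-strict
      rest + c′            <⟨ +-monoʳ-< rest c′<c+Bⁿ ⟩
      rest + (c + B ^ n)   ≡⟨ x∙yz≈zx∙y rest c (B ^ n) ⟩
      B ^ n + rest + c     ∎

  ⇓-τ : ∀ {Δ P P′ m} → Δ ⊢ P ⇓ m → P -[ τ ]→ P′ → ∃ λ m′ → Δ ⊢ P′ ⇓ m′ × m′ < m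
  ⇓-τ (par⇓ dP dQ) (t-comL P→ Q→ disj) with communicate dP P→ dQ Q→ disj
  ... | Θ , a′ , c′ , dP′ , dQ′ , lt = a′ + c′ , ⇓-νs _ Θ (par⇓ dP′ dQ′) , lt
  ⇓-τ (par⇓ {m₁ = a} {m₂ = c} dP dQ) (t-comR Q→ P→ disj) with communicate dQ Q→ dP P→ disj
  ... | Θ , c′ , a′ , dQ′ , dP′ , lt =
    a′ + c′ , ⇓-νs _ Θ (par⇓ dP′ dQ′) , subst₂-≡ _<_ (+-comm c′ a′) (+-comm c a) lt
  ⇓-τ (par⇓ {m₂ = c} dP dQ) (t-parL P→ _) with ⇓-τ dP P→
  ... | a′ , dP′ , a′<a = a′ + c , par⇓ dP′ dQ , +-monoˡ-< c a′<a
  ⇓-τ (par⇓ {m₁ = a} dP dQ) (t-parR Q→ _) with ⇓-τ dQ Q→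
  ... | c′ , dQ′ , c′<c = a + c′ , par⇓ dP dQ′ , +-monoʳ-< a c′<c
  ⇓-τ (ν⇓ s d) (t-res P→ _) with ⇓-τ d P→
  ... | m′ , d′ , m′<m = m′ , ν⇓ s d′ , m′<m
  ⇓-τ d (t-α P≡P′ P′→) = ⇓-τ (to (⇓-α P≡P′) d) P′→

  ⇓-terminates : ∀ {Δ P m} → Δ ⊢ P ⇓ m → Terminates P
  ⇓-terminates {m = m} = go (<-wellFounded m)
    where
    go : ∀ {Δ P m} → Acc _<_ m → Δ ⊢ P ⇓ m → Terminates P
    go (acc smaller) d (f , refl , step) with ⇓-τ d (step 0)
    ... | m′ , d′ , m′<m = go (smaller m′<m) d′ (f ∘ suc , refl , step ∘ suc)

-- Polarity and linearity are forgotten; the second object of an unrestricted channel is unit-typed.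
erase : Ty → Sort
erase (𝕚 n V₁ V₂) = chan (val n) (erase V₁) (erase V₂)
erase (𝕠 n V₁ V₂) = chan (val n) (erase V₁) (erase V₂)
erase (𝕊 n V) = chan (val n) (erase V) base
erase (ℂ n V) = chan (val n) (erase V) base
erase unit = base

erase-dual : ∀ V → erase (dual V) ≡ erase V
erase-dual (𝕚 n V₁ V₂) = cong₂ (chan (val n)) (erase-dual V₁) (erase-dual V₂)
erase-dual (𝕠 n V₁ V₂) = cong₂ (chan (val n)) (erase-dual V₁) (erase-dual V₂)
erase-dual (𝕊 n V) = cong (λ s → chan (val n) s base) (erase-dual V)
erase-dual (ℂ n V) = cong (λ s → chan (val n) s base) (erase-dual V)
erase-dual unit = refl

erase-weight : ∀ V {k s₁ s₂} → erase V ≡ chan k s₁ s₂ → weight V ≡ just k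
erase-weight (𝕚 n V₁ V₂) refl = refl
erase-weight (𝕠 n V₁ V₂) refl = refl
erase-weight (𝕊 n V) refl = refl
erase-weight (ℂ n V) refl = refl

eraseE : Entry → Sort
eraseE (one T) = erase T
eraseE (both V) = erase V

eraseM : Maybe Entry → Maybe Sort
eraseM = Maybe.map eraseE

⌊_⌋ : Ctx → SCtx
⌊ Γ ⌋ x = eraseM (Γ x)

⌊⌋-extend : ∀ Γ y e w → ⌊ extend Γ y e ⌋ w ≡ (⌊ Γ ⌋ [ y ≔ eraseE e ]) w
⌊⌋-extend Γ y e w with w ≡ᵇ y
... | true = refl
... | false = refl

≼-∋ : ∀ {Γ Δ x s} → ⌊ Γ ⌋ ≼ Δ → ⌊ Γ ⌋ x ≡ just s → Δ x ∋ s
≼-∋ {x = x} {s} Γ≼Δ Γx≡s = Γ≼Δ x (subst (_∋ s) (sym Γx≡s) (just-∋ s))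

⌊⌋-extend-same : ∀ Γ y e → ⌊ extend Γ y e ⌋ y ≡ just (eraseE e)
⌊⌋-extend-same Γ y e = cong eraseM (≔-same Γ y e)

≼-extend : ∀ {Γ Δ} y e → ⌊ Γ ⌋ ≼ Δ → ⌊ extend Γ y e ⌋ ≼ Δ [ y ≔ eraseE e ]
≼-extend {Γ} y e Γ≼Δ = ≼-trans (≼-reflexive (⌊⌋-extend Γ y e)) (≼-≔ y (eraseE e) Γ≼Δ)

≼-extend₂ : ∀ {Γ Δ} y₁ y₂ V₁ V₂ → ⌊ Γ ⌋ ≼ Δ → ⌊ Γ ⸴ y₁ ∶ V₁ ⸴ y₂ ∶ V₂ ⌋ ≼ Δ [ y₁ ≔ erase V₁ ] [ y₂ ≔ erase V₂ ]
≼-extend₂ y₁ y₂ V₁ V₂ = ≼-extend y₂ (one V₂) ∘ ≼-extend y₁ (one V₁)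

≼-extend-one-both : ∀ Γ y V → ⌊ Γ ⸴ y ∶ V ⌋ ≼ ⌊ Γ ⸴ y ∷ V ⌋
≼-extend-one-both Γ y V =
  ≼-reflexive λ w → trans (⌊⌋-extend Γ y (one V) w) (sym (⌊⌋-extend Γ y (both V) w))

≼-extend-unit : ∀ Γ y → ⌊ Γ ⸴ y ∶ unit ⌋ ≼ ⌊ Γ ⌋
≼-extend-unit Γ y = ≼-trans (≼-reflexive (⌊⌋-extend Γ y (one unit))) (≼-≔-base y λ _ → ≲-refl)

splitE-≲ : ∀ {a a₁ a₂} → SplitE a a₁ a₂ → eraseM a₁ ≲ eraseM a × eraseM a₂ ≲ eraseM a
splitE-≲ s-none = ≲-refl , ≲-refl
splitE-≲ (s-un-one _) = ≲-refl , ≲-refl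
splitE-≲ (s-un-both _) = ≲-refl , ≲-refl
splitE-≲ (s-lin-both {V} _) = ≲-refl , ≡⇒≲ (cong just (erase-dual V))
splitE-≲ (s-lin-both' {V} _) = ≡⇒≲ (cong just (erase-dual V)) , ≲-refl
splitE-≲ (s-lin-bothL _) = ≲-refl , nothing-≲
splitE-≲ (s-lin-bothR _) = nothing-≲ , ≲-refl
splitE-≲ (s-lin-oneL _) = ≲-refl , nothing-≲
splitE-≲ (s-lin-oneR _) = nothing-≲ , ≲-refl

split-≼ˡ : ∀ {Γ Γ₁ Γ₂} → Split Γ Γ₁ Γ₂ → ⌊ Γ₁ ⌋ ≼ ⌊ Γ ⌋
split-≼ˡ sp w = proj₁ (splitE-≲ (sp w))

split-≼ʳ : ∀ {Γ Γ₁ Γ₂} → Split Γ Γ₁ Γ₂ → ⌊ Γ₂ ⌋ ≼ ⌊ Γ ⌋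
split-≼ʳ sp w = proj₂ (splitE-≲ (sp w))

≈E⇒eraseM≡ : ∀ {a a′} → a ≈E a′ → eraseM a ≡ eraseM a′
≈E⇒eraseM≡ ≈-refl = refl
≈E⇒eraseM≡ (≈-dual {V}) = cong just (sym (erase-dual V))

≈⇒⌊⌋≡ : ∀ {Γ Γ′} → Γ ≈ Γ′ → ∀ w → ⌊ Γ ⌋ w ≡ ⌊ Γ′ ⌋ w
≈⇒⌊⌋≡ Γ≈Γ′ w = ≈E⇒eraseM≡ (Γ≈Γ′ w)

∉dom-≢ : ∀ Γ {y₁ y₂ V} → y₂ ∉dom (Γ ⸴ y₁ ∶ V) → y₁ ≢ y₂
∉dom-≢ Γ {y₁} {V = V} y₂∉ refl with trans (sym (≔-same Γ y₁ (one V))) y₂∉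
... | ()

outputs : Proc → ℕ
outputs (out x y₁ y₂ P) = suc (outputs P)
outputs (inp x y₁ y₂ P) = outputs P
outputs (rep x y₁ y₂ P) = outputs P
outputs (P ∣ Q) = outputs P + outputs Q
outputs (ν x P) = outputs P
outputs 𝟘 = 0

length-os≤outputs : ∀ P → length (os P) ≤ outputs P
length-os≤outputs (out x y₁ y₂ P) = s≤s (length-os≤outputs P)
length-os≤outputs (inp x y₁ y₂ P) = length-os≤outputs P
length-os≤outputs (rep x y₁ y₂ P) = z≤n
length-os≤outputs (P ∣ Q) rewrite length-++ (os P) {os Q} = +-mono-≤ (length-os≤outputs P) (length-os≤outputs Q)
length-os≤outputs (ν x P) = length-os≤outputs P
length-os≤outputs 𝟘 = z≤n

module Translation (l : Name → ℕ) (b : ℕ) where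
  open Typing l

  B : ℕ
  B = suc b

  open Measured B public

  cost : List Name → ℕ
  cost xs = sum (map (λ x → B ^ l x) xs)

  cost-++ : ∀ xs ys → cost (xs ++ ys) ≡ cost xs + cost ys
  cost-++ xs ys = trans (cong sum (map-++ (λ x → B ^ l x) xs ys)) (sum-++ (map (λ x → B ^ l x) xs) _)

  cost-≤ : ∀ {k} xs → All (λ c → l c ≤ k) xs → cost xs ≤ length xs * B ^ k
  cost-≤ [] [] = z≤n
  cost-≤ (c ∷ xs) (lc≤k ∷ all) = +-mono-≤ (^-monoʳ-≤ B lc≤k) (cost-≤ xs all)

  cost-< : ∀ {n} xs → All (λ c → l c < n) xs → length xs ≤ b → cost xs < B ^ n
  cost-< {zero} [] [] _ = s≤s z≤n
  cost-< {suc k} xs all |xs|≤b = begin-strict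
    cost xs            ≤⟨ cost-≤ xs (All.map s≤s⁻¹ all) ⟩
    length xs * B ^ k  ≤⟨ *-monoˡ-≤ (B ^ k) |xs|≤b ⟩
    b * B ^ k          <⟨ m<n+m (b * B ^ k) (m^n>0 B k) ⟩
    B ^ suc k          ∎
    where open ≤-Reasoning

  var-sort : ∀ {Γ x V} → Γ ⊢ₙ x ∶ V → ⌊ Γ ⌋ x ≡ just (erase V)
  var-sort (var₁ {Γ} {x} {V} _ _ _) = ⌊⌋-extend-same Γ x (one V)
  var-sort (var₂ {Γ} {x} {V} _ _ _) = ⌊⌋-extend-same Γ x (both V)
  var-sort {x = x} (convₙ Γ≈Γ′ d) = trans (≈⇒⌊⌋≡ Γ≈Γ′ x) (var-sort d)

  var-level : ∀ {Γ x V k} → Γ ⊢ₙ x ∶ V → weight V ≡ just k → l x ≡ k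
  var-level (var₁ {Γ} {x} {V} _ _ resp) = resp x (one V) _ (≔-same Γ x (one V))
  var-level (var₂ {Γ} {x} {V} _ _ resp) = resp x (both V) _ (≔-same Γ x (both V))
  var-level (convₙ _ d) = var-level d

  ⊢ₙ-∋ : ∀ {Γ Δ x V} → Γ ⊢ₙ x ∶ V → ⌊ Γ ⌋ ≼ Δ → Δ x ∋ erase V
  ⊢ₙ-∋ {Γ} d Γ≼Δ = ≼-∋ {Γ} Γ≼Δ (var-sort d)

  ⊢ₙ-∋-level : ∀ {Γ Δ x V k s₁ s₂} → Γ ⊢ₙ x ∶ V → ⌊ Γ ⌋ ≼ Δ → erase V ≡ chan k s₁ s₂ →
               Δ x ∋ chan (l x) s₁ s₂
  ⊢ₙ-∋-level {V = V} d Γ≼Δ eV rewrite var-level d (erase-weight V eV) = subst (_ ∋_) eV (⊢ₙ-∋ d Γ≼Δ)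

  ⊢⇒⇓ : ∀ {Γ Δ P} → Γ ⊢ P → outputs P ≤ b → ⌊ Γ ⌋ ≼ Δ → Δ ⊢ P ⇓ cost (os P)
  ⊢⇒⇓ (nil _ _) _ _ = 𝟘⇓
  ⊢⇒⇓ {Δ = Δ} (par {P = P} {Q} ⊢P ⊢Q sp _) bound Γ≼Δ =
    subst (Δ ⊢ P ∣ Q ⇓_) (sym (cost-++ (os P) (os Q)))
      (par⇓ (⊢⇒⇓ ⊢P (≤-trans (m≤m+n _ _) bound) (≼-trans (split-≼ˡ sp) Γ≼Δ))
            (⊢⇒⇓ ⊢Q (≤-trans (m≤n+m _ _) bound) (≼-trans (split-≼ʳ sp) Γ≼Δ)))
  ⊢⇒⇓ (res {x = x} {V} _ ⊢P _) bound Γ≼Δ = ν⇓ (erase V) (⊢⇒⇓ ⊢P bound (≼-extend x (both V) Γ≼Δ))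
  ⊢⇒⇓ (linIn₁ {Γ₂ = Γ₂} {y₁ = y₁} {y₂} {V₁ = V₁} {V₂} _ _ y₂∉ ⊢x ⊢P _ sp _) bound Γ≼Δ =
    inp⇓ (⊢ₙ-∋ ⊢x (≼-trans (split-≼ˡ sp) Γ≼Δ)) (∉dom-≢ Γ₂ y₂∉)
         (⊢⇒⇓ ⊢P bound (≼-extend₂ y₁ y₂ V₁ V₂ (≼-trans (split-≼ʳ sp) Γ≼Δ)))
  ⊢⇒⇓ (linIn₂ {Γ₂ = Γ₂} {x} {y₁} {y₂} {n} {V} _ _ _ y₂∉ ⊢x ⊢P sp _) bound Γ≼Δ =
    inp⇓ (⊢ₙ-∋ ⊢x (≼-trans (split-≼ˡ sp) Γ≼Δ)) (∉dom-≢ (Γ₂ ⸴ x ∶ 𝕊 n V) y₂∉)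
         (⊢⇒⇓ ⊢P bound (≼-extend₂ y₁ y₂ V unit (≼-trans (split-≼ʳ sp) Γ≼Δ)))
  ⊢⇒⇓ (linIn₃ {Γ} {x} {y₁} {y₂} {n} {V} _ _ y₂∉ ⊢x ⊢P _) bound Γ≼Δ =
    inp⇓ (⊢ₙ-∋ ⊢x Γ≼Δ) (∉dom-≢ (Γ ⸴ x ∷ 𝕊 n V) y₂∉) (⊢⇒⇓ ⊢P bound (≼-extend₂ y₁ y₂ V unit Γ≼Δ))
  ⊢⇒⇓ (linOut {Γ₃ = Γ₃} {y₂ = y₂} {V₂ = V₂} _ _ _ ⊢x ⊢y₁ ⊢P _ sp sp′ _) bound Γ≼Δ =
    out⇓ (⊢ₙ-∋-level ⊢x (≼-trans (split-≼ˡ sp) Γ≼Δ) refl) (⊢ₙ-∋ ⊢y₁ (≼-trans (split-≼ˡ sp′) Γ₂₃≼Δ))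
         (≼-∋ {Γ₃ ⸴ y₂ ∷ V₂} Γ₃≼Δ (⌊⌋-extend-same Γ₃ y₂ (both V₂)))
         (⊢⇒⇓ ⊢P (≤-trans (n≤1+n _) bound) (≼-trans (≼-extend-one-both Γ₃ y₂ V₂) Γ₃≼Δ))
    where
    Γ₂₃≼Δ = ≼-trans (split-≼ʳ sp) Γ≼Δ
    Γ₃≼Δ = ≼-trans (split-≼ʳ sp′) Γ₂₃≼Δ
  ⊢⇒⇓ (unOut₁ {Γ₃ = Γ₃} {x = x} {y₂ = y₂} {n} {V} _ _ _ _ _ ⊢x ⊢y₁ ⊢P sp sp′ _) bound Γ≼Δ =
    out⇓ (⊢ₙ-∋-level ⊢x (≼-trans (split-≼ˡ sp) Γ≼Δ) refl) (⊢ₙ-∋ ⊢y₁ (≼-trans (split-≼ˡ sp′) Γ₂₃≼Δ)) tt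
         (⊢⇒⇓ ⊢P (≤-trans (n≤1+n _) bound)
              (≼-trans (≼-extend-unit (Γ₃ ⸴ x ∶ ℂ n V) y₂) (≼-trans (split-≼ʳ sp′) Γ₂₃≼Δ)))
    where
    Γ₂₃≼Δ = ≼-trans (split-≼ʳ sp) Γ≼Δ
  ⊢⇒⇓ (unOut₂ {Γ₃ = Γ₃} {x = x} {y₂ = y₂} {n} {V} _ _ _ _ _ ⊢x ⊢y₁ ⊢P sp sp′ _) bound Γ≼Δ =
    out⇓ (⊢ₙ-∋-level ⊢x (≼-trans (split-≼ˡ sp) Γ≼Δ) refl) (⊢ₙ-∋ ⊢y₁ (≼-trans (split-≼ˡ sp′) Γ₂₃≼Δ)) tt
         (⊢⇒⇓ ⊢P (≤-trans (n≤1+n _) bound)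
              (≼-trans (≼-extend-unit (Γ₃ ⸴ x ∷ ℂ n V) y₂) (≼-trans (split-≼ʳ sp′) Γ₂₃≼Δ)))
    where
    Γ₂₃≼Δ = ≼-trans (split-≼ʳ sp) Γ≼Δ
  ⊢⇒⇓ (unIn₁ {Γ} {x} {y₁} {y₂} {n} {V} {P} _ _ y₂∉ ⊢x ⊢P os<n _) bound Γ≼Δ =
    rep⇓ (⊢ₙ-∋ ⊢x Γ≼Δ) (∉dom-≢ (Γ ⸴ x ∶ 𝕊 n V) y₂∉) (⊢⇒⇓ ⊢P bound (≼-extend₂ y₁ y₂ V unit Γ≼Δ))
         (cost-< (os P) os<n (≤-trans (length-os≤outputs P) bound))
  ⊢⇒⇓ (unIn₂ {Γ} {x} {y₁} {y₂} {n} {V} {P} _ _ y₂∉ ⊢x ⊢P os<n _) bound Γ≼Δ =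
    rep⇓ (⊢ₙ-∋ ⊢x Γ≼Δ) (∉dom-≢ (Γ ⸴ x ∷ 𝕊 n V) y₂∉) (⊢⇒⇓ ⊢P bound (≼-extend₂ y₁ y₂ V unit Γ≼Δ))
         (cost-< (os P) os<n (≤-trans (length-os≤outputs P) bound))
  ⊢⇒⇓ (conv Γ≈Γ′ ⊢P) bound Γ≼Δ = ⊢⇒⇓ ⊢P bound (≼-trans (≼-reflexive (sym ∘ ≈⇒⌊⌋≡ Γ≈Γ′)) Γ≼Δ)

mainTheorem3 : (Γ : Ctx) (P : Proc) → Finite Γ → (∃ λ (l : Name → ℕ) → Γ ⊢[ l ] P) → Terminates P
mainTheorem3 Γ P _ (l , ⊢P) = ⇓-terminates (⊢⇒⇓ ⊢P ≤-refl λ _ → ≲-refl)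
  where open Translation l (outputs P)
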